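{- Let $z$ be a formal variable and set $$\alpha_0=\frac{1-\sqrt{1-8z^2}}{4z},\qquad \beta_0=\frac{\alpha_0^2}{1+\alpha_0^2},$$ where $\sqrt{1-8z^2}$ denotes the formal power series square root with constant term $1$ (so $\alpha_0,\beta_0\in\mathbb{C}[[z]]$). Then $(\alpha_0,\beta_0)$ is the unique pair of nonzero formal power series $(\alpha,\beta)$ in $z$ such that $q_{i,j}=\alpha^i\beta^j$ ($i,j\ge0$) satisfies both $$q_{i,j}=z\,(q_{i-1,j+1}+q_{i+1,j-1}+q_{i+1,j+1})\quad\text{for all } i,j\ge1$$ and $$q_{i,0}=z\,(q_{i-1,1}+q_{i+1,1}+q_{i-1,0}+q_{i+1,0})\quad\text{for all } i\ge2 .$$
   Context: Here $\alpha^0=\beta^0=1$. -}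

module Defs where

open import Level using (Level; _⊔_)
open import Data.Nat using (ℕ; zero; suc; _∸_)
open import Data.Product using (Σ; _×_)
open import Relation.Nullary using (¬_)
open import Algebra.Bundles using (CommutativeRing)

module PowerSeries {c ℓ : Level} (R : CommutativeRing c ℓ) where
  open CommutativeRing R hiding (zero)

  Series : Set c
  Series = ℕ → Carrier

  _≋_ : Series → Series → Set ℓ
  f ≋ g = ∀ n → f n ≈ g n

  ι : ℕ → Carrier
  ι zero    = 0#
  ι (suc n) = 1# + ι n

  const : Carrier → Series
  const a zero    = a
  const a (suc n) = 0#

  0s 1s : Series
  0s = const 0#
  1s = const 1#

  zs : Series
  zs zero          = 0#
  zs (suc zero)    = 1#
  zs (suc (suc n)) = 0#

  _+s_ _-s_ : Series → Series → Series
  (f +s g) n = f n + g n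
  (f -s g) n = f n - g n

  sumTo : (ℕ → Carrier) → ℕ → Carrier
  sumTo h zero    = h zero
  sumTo h (suc n) = sumTo h n + h (suc n)

  _*s_ : Series → Series → Series
  (f *s g) n = sumTo (λ k → f k * g (n ∸ k)) n

  infixl 7 _*s_
  infixl 6 _+s_ _-s_
  infixr 8 _^s_
  infix 4 _≋_

  _^s_ : Series → ℕ → Series
  f ^s zero    = 1s
  f ^s (suc n) = f *s (f ^s n)

  NonZeroS : Series → Set ℓ
  NonZeroS f = ¬ (f ≋ 0s)

  IsFieldR : Set (c ⊔ ℓ)
  IsFieldR = (¬ (1# ≈ 0#)) × (∀ x → ¬ (x ≈ 0#) → Σ Carrier (λ y → x * y ≈ 1#))

  CharZero : Set ℓ
  CharZero = ∀ n → ¬ (ι (suc n) ≈ 0#)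

  -- s = sqrt(1 - 8 z^2), the square root with constant term 1
  IsSqrt : Series → Set ℓ
  IsSqrt s = (s 0 ≈ 1#) × (s *s s ≋ 1s -s const (ι 8) *s (zs ^s 2))

  -- α = (1 - s) / (4 z), i.e. the (unique) series with 4 z α = 1 - s
  IsAlpha0 : Series → Series → Set ℓ
  IsAlpha0 s α = const (ι 4) *s zs *s α ≋ 1s -s s

  -- β = α^2 / (1 + α^2), i.e. the (unique) series with (1 + α^2) β = α^2
  IsBeta0 : Series → Series → Set ℓ
  IsBeta0 α β = (1s +s α ^s 2) *s β ≋ α ^s 2

  q : Series → Series → ℕ → ℕ → Series
  q α β i j = (α ^s i) *s (β ^s j)

  Solution : Series → Series → Set ℓ
  Solution α β =
    NonZeroS α × NonZeroS β
    × (∀ i j → q α β (suc i) (suc j)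
                 ≋ zs *s (q α β i (suc (suc j)) +s q α β (suc (suc i)) j
                          +s q α β (suc (suc i)) (suc (suc j))))
    × (∀ i → q α β (suc (suc i)) 0
               ≋ zs *s (q α β (suc i) 1 +s q α β (suc (suc (suc i))) 1
                        +s q α β (suc i) 0 +s q α β (suc (suc (suc i))) 0))

module Submission where

-- AlphaBeta defines α₀ as the fixed
-- point of a ↦ z (1 + 2a²) (so 1 - 4zα₀ is √(1 - 8z²)) and β₀ by division;
-- the recurrences reduce to αβ = z (α² + β² + α²β²) and α = z(1 + α²)(1 + β).
-- A nonzero solution has α(1) invertible and α(0) = 0, so α cancels, and
-- eliminating β gives α = z (1 + 2α²), which has only one solution.

open import Level using (Level; _⊔_)
open import Algebra.Bundles using (CommutativeRing)
open import Algebra.Solver.Ring.AlmostCommutativeRing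
  using (_-Raw-AlmostCommutative⟶_; fromCommutativeRing)
open import Data.Nat as ℕ using (ℕ; zero; suc; _∸_; _≤_; _<_; z≤n)
import Data.Nat.Properties as ℕP
open import Data.Integer as ℤ using (ℤ; +_; -[1+_])
import Data.Integer.Properties as ℤP
open import Data.Sign as Sign using (Sign)
open import Data.Maybe using (Maybe; just; nothing)
open import Data.Product using (_,_; Σ; _×_; proj₁; proj₂)
open import Data.Sum using (inj₁; inj₂)
open import Relation.Nullary using (¬_; yes; no)
open import Relation.Binary.Structures using (IsEquivalence)
import Relation.Binary.PropositionalEquality as ≡
open import Defs

module IntegerSolver {c ℓ : Level} (R : CommutativeRing c ℓ) where
  open CommutativeRing R
  open import Algebra.Properties.Ring ring
    using (-0#≈0#; -‿involutive; -‿+-comm; -‿distribˡ-*; -‿distribʳ-*; x∙y⁻¹≈ε⇒x≈y; x≈y⇒x∙y⁻¹≈ε)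
  open import Algebra.Properties.Semiring.Mult.TCOptimised semiring
    using (1+×; ×-homo-+; ×1-homo-*) renaming (_×_ to _×ₙ_)
  open import Relation.Binary.Reasoning.Setoid setoid

  -- n ↦ n·1, optimised so that the image of 1 is 1# itself
  nat : ℕ → Carrier
  nat n = n ×ₙ 1#

  ⟦_⟧ᶻ : ℤ → Carrier
  ⟦ + n ⟧ᶻ      = nat n
  ⟦ -[1+ n ] ⟧ᶻ = - nat (suc n)

  ⟦-⟧ : ∀ i → ⟦ ℤ.- i ⟧ᶻ ≈ - ⟦ i ⟧ᶻ
  ⟦-⟧ (+ zero)  = sym -0#≈0#
  ⟦-⟧ (+ suc n) = refl
  ⟦-⟧ -[1+ n ]  = sym (-‿involutive _)

  ⟦⊖⟧ : ∀ m n → ⟦ m ℤ.⊖ n ⟧ᶻ ≈ nat m - nat n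
  ⟦⊖⟧ zero    zero    = sym (trans (+-congˡ -0#≈0#) (+-identityʳ _))
  ⟦⊖⟧ zero    (suc n) = sym (+-identityˡ _)
  ⟦⊖⟧ (suc m) zero    = sym (trans (+-congˡ -0#≈0#) (+-identityʳ _))
  ⟦⊖⟧ (suc m) (suc n) = begin
    ⟦ suc m ℤ.⊖ suc n ⟧ᶻ              ≡⟨ ≡.cong ⟦_⟧ᶻ (ℤP.[1+m]⊖[1+n]≡m⊖n m n) ⟩
    ⟦ m ℤ.⊖ n ⟧ᶻ                      ≈⟨ ⟦⊖⟧ m n ⟩
    nat m - nat n                     ≈⟨ +-congˡ (sym (trans (+-congʳ (-‿inverseʳ 1#)) (+-identityˡ _))) ⟩
    nat m + ((1# - 1#) - nat n)       ≈⟨ +-congˡ (+-assoc _ _ _) ⟩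
    nat m + (1# + (- 1# - nat n))     ≈⟨ sym (+-assoc _ _ _) ⟩
    (nat m + 1#) + (- 1# - nat n)     ≈⟨ +-cong (+-comm _ _) (-‿+-comm _ _) ⟩
    (1# + nat m) - (1# + nat n)       ≈⟨ sym (+-cong (1+× m 1#) (-‿cong (1+× n 1#))) ⟩
    nat (suc m) - nat (suc n)         ∎

  ⟦+⟧ : ∀ i j → ⟦ i ℤ.+ j ⟧ᶻ ≈ ⟦ i ⟧ᶻ + ⟦ j ⟧ᶻ
  ⟦+⟧ (+ m)    (+ n)    = ×-homo-+ 1# m n
  ⟦+⟧ (+ m)    -[1+ n ] = ⟦⊖⟧ m (suc n)
  ⟦+⟧ -[1+ m ] (+ n)    = trans (⟦⊖⟧ n (suc m)) (+-comm _ _)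
  ⟦+⟧ -[1+ m ] -[1+ n ] = begin
    - nat (suc (suc (m ℕ.+ n)))   ≡⟨ ≡.cong (λ k → - nat (suc k)) (≡.sym (ℕP.+-suc m n)) ⟩
    - nat (suc m ℕ.+ suc n)       ≈⟨ -‿cong (×-homo-+ 1# (suc m) (suc n)) ⟩
    - (nat (suc m) + nat (suc n)) ≈⟨ sym (-‿+-comm _ _) ⟩
    - nat (suc m) - nat (suc n)   ∎

  signed : Sign → Carrier → Carrier
  signed Sign.+ x = x
  signed Sign.- x = - x

  signed-cong : ∀ s {x y} → x ≈ y → signed s x ≈ signed s y
  signed-cong Sign.+ p = p
  signed-cong Sign.- p = -‿cong p

  ⟦◃⟧ : ∀ s n → ⟦ s ℤ.◃ n ⟧ᶻ ≈ signed s (nat n)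
  ⟦◃⟧ Sign.+ zero    = refl
  ⟦◃⟧ Sign.- zero    = sym -0#≈0#
  ⟦◃⟧ Sign.+ (suc n) = refl
  ⟦◃⟧ Sign.- (suc n) = refl

  ⟦sign∣∣⟧ : ∀ i → ⟦ i ⟧ᶻ ≈ signed (ℤ.sign i) (nat ℤ.∣ i ∣)
  ⟦sign∣∣⟧ (+ n)    = refl
  ⟦sign∣∣⟧ -[1+ n ] = refl

  signed-* : ∀ s t a b → signed (s Sign.* t) (a * b) ≈ signed s a * signed t b
  signed-* Sign.+ Sign.+ a b = refl
  signed-* Sign.+ Sign.- a b = -‿distribʳ-* a b
  signed-* Sign.- Sign.+ a b = -‿distribˡ-* a b
  signed-* Sign.- Sign.- a b = begin
    a * b           ≈⟨ sym (-‿involutive _) ⟩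
    - - (a * b)     ≈⟨ -‿cong (-‿distribʳ-* a b) ⟩
    - (a * - b)     ≈⟨ -‿distribˡ-* a (- b) ⟩
    - a * - b       ∎

  ⟦*⟧ : ∀ i j → ⟦ i ℤ.* j ⟧ᶻ ≈ ⟦ i ⟧ᶻ * ⟦ j ⟧ᶻ
  ⟦*⟧ i j = begin
    ⟦ s ℤ.◃ (ℤ.∣ i ∣ ℕ.* ℤ.∣ j ∣) ⟧ᶻ          ≈⟨ ⟦◃⟧ s (ℤ.∣ i ∣ ℕ.* ℤ.∣ j ∣) ⟩
    signed s (nat (ℤ.∣ i ∣ ℕ.* ℤ.∣ j ∣))      ≈⟨ signed-cong s (×1-homo-* ℤ.∣ i ∣ ℤ.∣ j ∣) ⟩
    signed s (nat ℤ.∣ i ∣ * nat ℤ.∣ j ∣)      ≈⟨ signed-* (ℤ.sign i) (ℤ.sign j) _ _ ⟩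
    signed (ℤ.sign i) (nat ℤ.∣ i ∣) * signed (ℤ.sign j) (nat ℤ.∣ j ∣) ≈⟨ sym (*-cong (⟦sign∣∣⟧ i) (⟦sign∣∣⟧ j)) ⟩
    ⟦ i ⟧ᶻ * ⟦ j ⟧ᶻ                           ∎
    where
    s : Sign
    s = ℤ.sign i Sign.* ℤ.sign j

  ℤ⟶R : ℤ.+-*-rawRing -Raw-AlmostCommutative⟶ fromCommutativeRing R
  ℤ⟶R = record
    { ⟦_⟧    = ⟦_⟧ᶻ
    ; +-homo = ⟦+⟧
    ; *-homo = ⟦*⟧
    ; -‿homo = ⟦-⟧
    ; 0-homo = refl
    ; 1-homo = refl
    }

  ℤ-equal? : ∀ i j → Maybe (⟦ i ⟧ᶻ ≈ ⟦ j ⟧ᶻ)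
  ℤ-equal? i j with i ℤ.≟ j
  ... | yes ≡.refl = just refl
  ... | no _       = nothing

  open import Algebra.Solver.Ring ℤ.+-*-rawRing (fromCommutativeRing R) ℤ⟶R ℤ-equal? public

  -- Certificates: an equation x ≈ y is proved by exhibiting x - y as a
  -- combination of differences already known to vanish.
  difference : ∀ {x y} → x ≈ y → x - y ≈ 0#
  difference = x≈y⇒x∙y⁻¹≈ε

  from-difference : ∀ {x y} → x - y ≈ 0# → x ≈ y
  from-difference = x∙y⁻¹≈ε⇒x≈y _ _

  scaled-vanishes : ∀ {a D} → D ≈ 0# → a * D ≈ 0#
  scaled-vanishes p = trans (*-congˡ p) (zeroʳ _)

  vanishes₁ : ∀ {T a D} → T ≈ a * D → D ≈ 0# → T ≈ 0#
  vanishes₁ e p = trans e (scaled-vanishes p)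

  vanishes₂ : ∀ {T a D b E} → T ≈ a * D + b * E → D ≈ 0# → E ≈ 0# → T ≈ 0#
  vanishes₂ e p q = trans e (trans (+-cong (scaled-vanishes p) (scaled-vanishes q)) (+-identityʳ 0#))

  vanishes₃ : ∀ {T a D b E c F} → T ≈ a * D + b * E + c * F →
              D ≈ 0# → E ≈ 0# → F ≈ 0# → T ≈ 0#
  vanishes₃ e p q r = trans e (trans (+-cong (vanishes₂ refl p q) (scaled-vanishes r)) (+-identityʳ 0#))

  vanishes₄ : ∀ {T a D b E c F d G} → T ≈ a * D + b * E + c * F + d * G →
              D ≈ 0# → E ≈ 0# → F ≈ 0# → G ≈ 0# → T ≈ 0#
  vanishes₄ e p q r t = trans e (trans (+-cong (vanishes₃ refl p q r) (scaled-vanishes t)) (+-identityʳ 0#))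

module SeriesRing {c ℓ : Level} (R : CommutativeRing c ℓ) where
  open CommutativeRing R hiding (zero)
  open PowerSeries R
  open import Algebra.Properties.CommutativeSemigroup +-commutativeSemigroup using (interchange)
  open import Relation.Binary.Reasoning.Setoid setoid

  sumTo-cong : ∀ {h h'} n → (∀ k → k ≤ n → h k ≈ h' k) → sumTo h n ≈ sumTo h' n
  sumTo-cong zero    p = p 0 z≤n
  sumTo-cong (suc n) p = +-cong (sumTo-cong n (λ k k≤n → p k (ℕP.m≤n⇒m≤1+n k≤n))) (p (suc n) ℕP.≤-refl)

  sumTo-vanishes : ∀ h n → (∀ k → k ≤ n → h k ≈ 0#) → sumTo h n ≈ 0#
  sumTo-vanishes h zero    p = p 0 z≤n
  sumTo-vanishes h (suc n) p =
    trans (+-cong (sumTo-vanishes h n (λ k k≤n → p k (ℕP.m≤n⇒m≤1+n k≤n))) (p (suc n) ℕP.≤-refl)) (+-identityʳ 0#)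

  sumTo-+ : ∀ h h' n → sumTo (λ k → h k + h' k) n ≈ sumTo h n + sumTo h' n
  sumTo-+ h h' zero    = refl
  sumTo-+ h h' (suc n) = trans (+-congʳ (sumTo-+ h h' n)) (interchange _ _ _ _)

  sumTo-*ˡ : ∀ a h n → sumTo (λ k → a * h k) n ≈ a * sumTo h n
  sumTo-*ˡ a h zero    = refl
  sumTo-*ˡ a h (suc n) = trans (+-congʳ (sumTo-*ˡ a h n)) (sym (distribˡ _ _ _))

  sumTo-first : ∀ h n → sumTo h (suc n) ≈ h 0 + sumTo (λ k → h (suc k)) n
  sumTo-first h zero    = refl
  sumTo-first h (suc n) = trans (+-congʳ (sumTo-first h n)) (+-assoc _ _ _)

  sumTo-reverse : ∀ h n → sumTo h n ≈ sumTo (λ k → h (n ∸ k)) n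
  sumTo-reverse h zero    = refl
  sumTo-reverse h (suc n) = begin
    sumTo h n + h (suc n)                  ≈⟨ +-comm _ _ ⟩
    h (suc n) + sumTo h n                  ≈⟨ +-congˡ (sumTo-reverse h n) ⟩
    h (suc n) + sumTo (λ k → h (n ∸ k)) n  ≈⟨ sym (sumTo-first (λ k → h (suc n ∸ k)) n) ⟩
    sumTo (λ k → h (suc n ∸ k)) (suc n)    ∎

  tail : Series → Series
  tail f n = f (suc n)

  scale : Carrier → Series → Series
  scale a f n = a * f n

  *s-cong : ∀ {f f' g g'} → f ≋ f' → g ≋ g' → f *s g ≋ f' *s g'
  *s-cong p q n = sumTo-cong n (λ k _ → *-cong (p k) (q (n ∸ k)))

  *s-comm : ∀ f g → f *s g ≋ g *s f
  *s-comm f g n = begin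
    sumTo (λ k → f k * g (n ∸ k)) n               ≈⟨ sumTo-reverse _ n ⟩
    sumTo (λ k → f (n ∸ k) * g (n ∸ (n ∸ k))) n   ≈⟨ sumTo-cong n swap ⟩
    sumTo (λ k → g k * f (n ∸ k)) n               ∎
    where
    swap : ∀ k → k ≤ n → f (n ∸ k) * g (n ∸ (n ∸ k)) ≈ g k * f (n ∸ k)
    swap k k≤n = trans (*-comm _ _) (*-congʳ (reflexive (≡.cong g (ℕP.m∸[m∸n]≡n k≤n))))

  *s-distribʳ : ∀ f g h → (f +s g) *s h ≋ f *s h +s g *s h
  *s-distribʳ f g h n = trans (sumTo-cong n (λ k _ → distribʳ _ _ _)) (sumTo-+ _ _ n)

  *s-identityˡ : ∀ f → 1s *s f ≋ f
  *s-identityˡ f zero    = *-identityˡ _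
  *s-identityˡ f (suc n) = begin
    (1s *s f) (suc n)                                      ≈⟨ sumTo-first _ n ⟩
    1# * f (suc n) + sumTo (λ k → 0# * f (n ∸ k)) n        ≈⟨ +-cong (*-identityˡ _) (sumTo-vanishes _ n (λ k _ → zeroˡ _)) ⟩
    f (suc n) + 0#                                         ≈⟨ +-identityʳ _ ⟩
    f (suc n)                                              ∎

  *s-suc : ∀ f g n → (f *s g) (suc n) ≈ f 0 * g (suc n) + (tail f *s g) n
  *s-suc f g n = sumTo-first _ n

  -- by induction on the coefficient, peeling off the first factor with *s-suc
  *s-assoc : ∀ f g h → (f *s g) *s h ≋ f *s (g *s h)
  *s-assoc f g h zero    = *-assoc _ _ _
  *s-assoc f g h (suc n) = begin
    ((f *s g) *s h) (suc n)                                       ≈⟨ *s-suc (f *s g) h n ⟩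
    (f 0 * g 0) * h (suc n) + (tail (f *s g) *s h) n              ≈⟨ +-congˡ (*s-cong {g = h} (*s-suc f g) (λ _ → refl) n) ⟩
    (f 0 * g 0) * h (suc n) + ((scale (f 0) (tail g) +s tail f *s g) *s h) n ≈⟨ +-congˡ (*s-distribʳ _ _ h n) ⟩
    (f 0 * g 0) * h (suc n) + ((scale (f 0) (tail g) *s h) n + ((tail f *s g) *s h) n)
                                                                  ≈⟨ +-congˡ (+-cong scale-out (*s-assoc (tail f) g h n)) ⟩
    (f 0 * g 0) * h (suc n) + (f 0 * (tail g *s h) n + (tail f *s (g *s h)) n) ≈⟨ sym (+-assoc _ _ _) ⟩
    ((f 0 * g 0) * h (suc n) + f 0 * (tail g *s h) n) + (tail f *s (g *s h)) n
                                                                  ≈⟨ +-congʳ (trans (+-congʳ (*-assoc _ _ _)) (sym (distribˡ _ _ _))) ⟩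
    f 0 * (g 0 * h (suc n) + (tail g *s h) n) + (tail f *s (g *s h)) n ≈⟨ +-congʳ (*-congˡ (sym (*s-suc g h n))) ⟩
    f 0 * (g *s h) (suc n) + (tail f *s (g *s h)) n               ≈⟨ sym (*s-suc f (g *s h) n) ⟩
    (f *s (g *s h)) (suc n)                                       ∎
    where
    scale-out : (scale (f 0) (tail g) *s h) n ≈ f 0 * (tail g *s h) n
    scale-out = trans (sumTo-cong n (λ k _ → *-assoc _ _ _)) (sumTo-*ˡ (f 0) _ n)

  ≋-isEquivalence : IsEquivalence _≋_
  ≋-isEquivalence = record
    { refl  = λ _ → refl
    ; sym   = λ p n → sym (p n)
    ; trans = λ p q n → trans (p n) (q n)
    }

  0s-coeff : ∀ n → 0s n ≈ 0#
  0s-coeff zero    = refl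
  0s-coeff (suc n) = refl

  -s_ : Series → Series
  (-s f) n = - f n

  seriesRing : CommutativeRing c ℓ
  seriesRing = record
    { Carrier = Series
    ; _≈_     = _≋_
    ; _+_     = _+s_
    ; _*_     = _*s_
    ; -_      = -s_
    ; 0#      = 0s
    ; 1#      = 1s
    ; isCommutativeRing = record
      { isRing = record
        { +-isAbelianGroup = record
          { isGroup = record
            { isMonoid = record
              { isSemigroup = record
                { isMagma = record
                  { isEquivalence = ≋-isEquivalence
                  ; ∙-cong        = λ p q n → +-cong (p n) (q n) }
                ; assoc = λ f g h n → +-assoc _ _ _ }
              ; identity = (λ f n → trans (+-congʳ (0s-coeff n)) (+-identityˡ _))
                         , (λ f n → trans (+-congˡ (0s-coeff n)) (+-identityʳ _)) }
            ; inverse = (λ f n → trans (-‿inverseˡ _) (sym (0s-coeff n)))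
                      , (λ f n → trans (-‿inverseʳ _) (sym (0s-coeff n)))
            ; ⁻¹-cong = λ p n → -‿cong (p n) }
          ; comm = λ f g n → +-comm _ _ }
        ; *-cong     = *s-cong
        ; *-assoc    = *s-assoc
        ; *-identity = *s-identityˡ , (λ f n → trans (*s-comm f 1s n) (*s-identityˡ f n))
        ; distrib    = (λ h f g n → trans (*s-comm h (f +s g) n)
                                      (trans (*s-distribʳ f g h n) (+-cong (*s-comm f h n) (*s-comm g h n))))
                     , (λ h f g → *s-distribʳ f g h) }
      ; *-comm = *s-comm } }

  z*-coeff₀ : ∀ g → (zs *s g) 0 ≈ 0#
  z*-coeff₀ g = zeroˡ _

  z*-coeff-suc : ∀ g n → (zs *s g) (suc n) ≈ g n
  z*-coeff-suc g zero    = trans (+-cong (zeroˡ _) (*-identityˡ _)) (+-identityˡ _)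
  z*-coeff-suc g (suc n) = begin
    (zs *s g) (suc (suc n))                                             ≈⟨ sumTo-first _ (suc n) ⟩
    0# * g (suc (suc n)) + sumTo (λ k → zs (suc k) * g (suc n ∸ k)) (suc n) ≈⟨ +-cong (zeroˡ _) (sumTo-first _ n) ⟩
    0# + (1# * g (suc n) + sumTo (λ k → 0# * g (n ∸ k)) n)              ≈⟨ +-identityˡ _ ⟩
    1# * g (suc n) + sumTo (λ k → 0# * g (n ∸ k)) n                     ≈⟨ +-cong (*-identityˡ _) (sumTo-vanishes _ n (λ k _ → zeroˡ _)) ⟩
    g (suc n) + 0#                                                      ≈⟨ +-identityʳ _ ⟩
    g (suc n)                                                           ∎

  z-cancel : ∀ g → zs *s g ≋ 0s → g ≋ 0s
  z-cancel g p n = trans (sym (z*-coeff-suc g n)) (trans (p (suc n)) (sym (0s-coeff n)))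

  z-divides : ∀ f → f 0 ≈ 0# → f ≋ zs *s tail f
  z-divides f p zero    = trans p (sym (z*-coeff₀ (tail f)))
  z-divides f p (suc n) = sym (z*-coeff-suc (tail f) n)

  unit-cancel : ∀ f g a → f 0 * a ≈ 1# → f *s g ≋ 0s → g ≋ 0s
  unit-cancel f g a fa fg n = trans (vanishes-upto n n ℕP.≤-refl) (sym (0s-coeff n))
    where
    gf-coeff : ∀ n → (g *s f) n ≈ 0#
    gf-coeff n = trans (*s-comm g f n) (trans (fg n) (0s-coeff n))
    cancel-f₀ : ∀ n → g n * f 0 ≈ 0# → g n ≈ 0#
    cancel-f₀ n p = begin
      g n                ≈⟨ sym (*-identityʳ _) ⟩
      g n * 1#           ≈⟨ *-congˡ (sym fa) ⟩
      g n * (f 0 * a)    ≈⟨ sym (*-assoc _ _ _) ⟩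
      (g n * f 0) * a    ≈⟨ *-congʳ p ⟩
      0# * a             ≈⟨ zeroˡ _ ⟩
      0#                 ∎
    -- coefficient m+1 of g·f is g (m+1)·f 0 plus terms with earlier coefficients of g
    vanishes-upto : ∀ n k → k ≤ n → g k ≈ 0#
    vanishes-upto zero k k≤0 with ℕP.n≤0⇒n≡0 k≤0
    ... | ≡.refl = cancel-f₀ 0 (gf-coeff 0)
    vanishes-upto (suc m) k k≤ with ℕP.m≤n⇒m<n∨m≡n k≤
    ... | inj₁ k<  = vanishes-upto m k (ℕP.≤-pred k<)
    ... | inj₂ ≡.refl = cancel-f₀ (suc m) (begin
      g (suc m) * f 0                                     ≈⟨ sym (+-identityˡ _) ⟩
      0# + g (suc m) * f 0                                ≈⟨ +-cong (sym earlier) (*-congˡ (reflexive (≡.cong f (≡.sym (ℕP.n∸n≡0 m))))) ⟩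
      (g *s f) (suc m)                                    ≈⟨ gf-coeff (suc m) ⟩
      0#                                                  ∎)
      where
      earlier : sumTo (λ j → g j * f (suc m ∸ j)) m ≈ 0#
      earlier = sumTo-vanishes _ m (λ j j≤ → trans (*-congʳ (vanishes-upto m j j≤)) (zeroˡ _))

  module S = CommutativeRing seriesRing
  open import Algebra.Properties.Ring S.ring using (x∙y⁻¹≈ε⇒x≈y; x≈y⇒x∙y⁻¹≈ε; x[y-z]≈xy-xz)

  unit-cancelˡ : ∀ f g g' a → f 0 * a ≈ 1# → f *s g ≋ f *s g' → g ≋ g'
  unit-cancelˡ f g g' a fa e =
    x∙y⁻¹≈ε⇒x≈y g g' (unit-cancel f (g -s g') a fa (S.trans (x[y-z]≈xy-xz f g g') (x≈y⇒x∙y⁻¹≈ε e)))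

  Agree : ℕ → Series → Series → Set ℓ
  Agree n f g = ∀ k → k < n → f k ≈ g k

  agree-refl : ∀ {n} f → Agree n f f
  agree-refl f _ _ = refl

  agree-trans : ∀ {n f g h} → Agree n f g → Agree n g h → Agree n f h
  agree-trans p q k k< = trans (p k k<) (q k k<)

  agree-weaken : ∀ {m n f g} → m ≤ n → Agree n f g → Agree m f g
  agree-weaken m≤n p k k< = p k (ℕP.<-≤-trans k< m≤n)

  agree-+ : ∀ {n f f' g g'} → Agree n f f' → Agree n g g' → Agree n (f +s g) (f' +s g')
  agree-+ p q k k< = +-cong (p k k<) (q k k<)

  agree-- : ∀ {n f f' g g'} → Agree n f f' → Agree n g g' → Agree n (f -s g) (f' -s g')
  agree-- p q k k< = +-cong (p k k<) (-‿cong (q k k<))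

  agree-* : ∀ {n f f' g g'} → Agree n f f' → Agree n g g' → Agree n (f *s g) (f' *s g')
  agree-* p q k k< = sumTo-cong k (λ i i≤k →
    *-cong (p i (ℕP.≤-<-trans i≤k k<)) (q (k ∸ i) (ℕP.≤-<-trans (ℕP.m∸n≤m k i) k<)))

  agree-z : ∀ {n f g} → Agree n f g → Agree (suc n) (zs *s f) (zs *s g)
  agree-z {f = f} {g} p zero    _  = trans (z*-coeff₀ f) (sym (z*-coeff₀ g))
  agree-z {f = f} {g} p (suc k) k< = trans (z*-coeff-suc f k) (trans (p k (ℕP.≤-pred k<)) (sym (z*-coeff-suc g k)))

  Contractive : (Series → Series) → Set (c ⊔ ℓ)
  Contractive F = ∀ n f g → Agree n f g → Agree (suc n) (F f) (F g)

  module FixedPoint (F : Series → Series) (contractive : Contractive F) where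
    iterate : ℕ → Series
    iterate zero    = 0s
    iterate (suc m) = F (iterate m)

    iterate-step : ∀ m → Agree m (iterate m) (iterate (suc m))
    iterate-step zero    k ()
    iterate-step (suc m) = contractive m _ _ (iterate-step m)

    iterate-stable : ∀ j m → Agree m (iterate m) (iterate (j ℕ.+ m))
    iterate-stable zero    m = agree-refl _
    iterate-stable (suc j) m =
      agree-trans (iterate-stable j m) (agree-weaken (ℕP.m≤n+m m j) (iterate-step (j ℕ.+ m)))

    iterate-stable≤ : ∀ {m m'} → m ≤ m' → Agree m (iterate m) (iterate m')
    iterate-stable≤ {m} {m'} m≤m' k k< =
      trans (iterate-stable (m' ∸ m) m k k<) (reflexive (≡.cong (λ t → iterate t k) (ℕP.m∸n+n≡m m≤m')))

    -- the coefficient n is settled after n+1 iterations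
    fixpoint : Series
    fixpoint n = iterate (suc n) n

    iterate-agrees : ∀ n → Agree n (iterate n) fixpoint
    iterate-agrees n k k< = sym (iterate-stable≤ k< k ℕP.≤-refl)

    fixpoint-eq : fixpoint ≋ F fixpoint
    fixpoint-eq n = contractive n _ _ (iterate-agrees n) n ℕP.≤-refl

    fixpoint-unique : ∀ f → f ≋ F f → f ≋ fixpoint
    fixpoint-unique f f-eq n = agrees (suc n) n ℕP.≤-refl
      where
      agrees : ∀ m → Agree m f fixpoint
      agrees zero    k ()
      agrees (suc m) k k< =
        trans (f-eq k) (trans (contractive m _ _ (agrees m) k k<) (sym (fixpoint-eq k)))

  divide : ∀ t c → Σ Series (λ x → (1s +s zs *s t) *s x ≋ c)
  divide t c = fixpoint , solves
    where
    divMap : Series → Series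
    divMap x = c -s zs *s (t *s x)

    open FixedPoint divMap (λ n f g p → agree-- (agree-refl c) (agree-z (agree-* (agree-refl t) p)))

    solves : (1s +s zs *s t) *s fixpoint ≋ c
    solves = S.trans (S.distribʳ fixpoint 1s (zs *s t)) (λ n → begin
      (1s *s fixpoint +s (zs *s t) *s fixpoint) n            ≈⟨ +-cong (*s-identityˡ fixpoint n) (*s-assoc zs t fixpoint n) ⟩
      fixpoint n + (zs *s (t *s fixpoint)) n                  ≈⟨ +-congʳ (fixpoint-eq n) ⟩
      (c n - (zs *s (t *s fixpoint)) n) + (zs *s (t *s fixpoint)) n ≈⟨ +-assoc _ _ _ ⟩
      c n + (- (zs *s (t *s fixpoint)) n + (zs *s (t *s fixpoint)) n) ≈⟨ +-congˡ (-‿inverseˡ _) ⟩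
      c n + 0#                                                ≈⟨ +-identityʳ _ ⟩
      c n                                                     ∎)

module AlphaBeta {c ℓ : Level} (R : CommutativeRing c ℓ) where
  open CommutativeRing R hiding (zero)
  open PowerSeries R
  open SeriesRing R
  open import Relation.Binary.Reasoning.Setoid setoid
  open import Algebra.Properties.Ring ring using (-0#≈0#)

  module SeriesSolver = IntegerSolver seriesRing
  module CoeffSolver = IntegerSolver R
  open SeriesSolver using (_:+_; _:*_; _:-_; _:^_; :-_; con; _:=_; solve; Polynomial;
                           difference; from-difference; vanishes₁; vanishes₂)

  one two : ∀ {n} → Polynomial n
  one = con (+ 1)
  two = con (+ 2)

  -- α₀ is the fixed point of a ↦ z (1 + 2a²), the equation that
  -- (1 - √(1 - 8z²)) / (4z) satisfies
  αMap : Series → Series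
  αMap a = zs *s (1s +s (1s +s 1s) *s (a *s a))

  αMap-contractive : Contractive αMap
  αMap-contractive n f g p = agree-z (agree-+ (agree-refl 1s) (agree-* (agree-refl (1s +s 1s)) (agree-* p p)))

  open FixedPoint αMap αMap-contractive public
    using () renaming (fixpoint to α₀; fixpoint-eq to α₀-eq; fixpoint-unique to αMap-unique)

  α₀-coeff₀ : α₀ 0 ≈ 0#
  α₀-coeff₀ = trans (α₀-eq 0) (z*-coeff₀ (1s +s (1s +s 1s) *s (α₀ *s α₀)))

  α₀-coeff₁ : α₀ 1 ≈ 1#
  α₀-coeff₁ = begin
    α₀ 1                                          ≈⟨ α₀-eq 1 ⟩
    αMap α₀ 1                                     ≈⟨ z*-coeff-suc (1s +s (1s +s 1s) *s (α₀ *s α₀)) 0 ⟩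
    1# + (1# + 1#) * (α₀ 0 * α₀ 0)                ≈⟨ +-congˡ (trans (*-congˡ (trans (*-congʳ α₀-coeff₀) (zeroˡ _))) (zeroʳ _)) ⟩
    1# + 0#                                       ≈⟨ +-identityʳ 1# ⟩
    1#                                            ∎

  c₀ : Series
  c₀ = (1s +s (1s +s 1s) *s (α₀ *s α₀)) *s α₀

  α₀²-divisible : α₀ ^s 2 ≋ zs *s c₀
  α₀²-divisible = from-difference (vanishes₁
    (solve 2 (λ a z → a :^ 2 :- z :* ((one :+ two :* (a :* a)) :* a)
                      := a :* (a :- z :* (one :+ two :* (a :* a)))) S.refl α₀ zs)
    (difference α₀-eq))

  -- β₀ = α₀² / (1 + α₀²), which makes sense as 1 + α₀² = 1 + z c₀
  β₀ : Series
  β₀ = proj₁ (divide c₀ (α₀ ^s 2))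

  β₀-isBeta : IsBeta0 α₀ β₀
  β₀-isBeta = S.trans (S.*-congʳ {β₀} (S.+-congˡ {1s} α₀²-divisible)) (proj₂ (divide c₀ (α₀ ^s 2)))

  -- The two recurrences for q_{i,j} = α^i β^j reduce to their instances
  -- (i,j) = (1,1) and (after cancelling α) (2,0):
  --   αβ = z (α² + β² + α²β²)   and   α = z (1 + α²)(1 + β).
  InteriorEq : Series → Series → Set ℓ
  InteriorEq α β = α *s β ≋ zs *s (α *s α +s β *s β +s (α *s α) *s (β *s β))

  weight : Series → Series → Series
  weight α β = (1s +s α *s α) *s (1s +s β)

  BoundaryEq : Series → Series → Set ℓ
  BoundaryEq α β = α ≋ zs *s weight α β

  -- each instance of a recurrence is a multiple of the reduced equation
  interior-recurrence : ∀ α β → InteriorEq α β →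
    ∀ i j → q α β (suc i) (suc j)
              ≋ zs *s (q α β i (suc (suc j)) +s q α β (suc (suc i)) j +s q α β (suc (suc i)) (suc (suc j)))
  interior-recurrence α β eq i j = from-difference (vanishes₁
    (solve 5 (λ a b z A B →
       (a :* A) :* (b :* B) :- z :* (A :* (b :* (b :* B)) :+ (a :* (a :* A)) :* B :+ (a :* (a :* A)) :* (b :* (b :* B)))
       := (A :* B) :* (a :* b :- z :* (a :* a :+ b :* b :+ (a :* a) :* (b :* b))))
       S.refl α β zs (α ^s i) (β ^s j))
    (difference eq))

  boundary-recurrence : ∀ α β → BoundaryEq α β →
    ∀ i → q α β (suc (suc i)) 0
            ≋ zs *s (q α β (suc i) 1 +s q α β (suc (suc (suc i))) 1 +s q α β (suc i) 0 +s q α β (suc (suc (suc i))) 0)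
  boundary-recurrence α β eq i = from-difference (vanishes₁
    (solve 4 (λ a b z A →
       (a :* (a :* A)) :* one :- z :* ((a :* A) :* (b :* one) :+ (a :* (a :* (a :* A))) :* (b :* one)
                                      :+ (a :* A) :* one :+ (a :* (a :* (a :* A))) :* one)
       := (a :* A) :* (a :- z :* ((one :+ a :* a) :* (one :+ b))))
       S.refl α β zs (α ^s i))
    (difference eq))

  one-plus-square-unit : ∀ α → α 0 ≈ 0# → (1s +s α ^s 2) 0 * 1# ≈ 1#
  one-plus-square-unit α α0≈0 = begin
    (1# + α 0 * (α 0 * 1#)) * 1#  ≈⟨ *-identityʳ _ ⟩
    1# + α 0 * (α 0 * 1#)         ≈⟨ +-congˡ (trans (*-congʳ α0≈0) (zeroˡ _)) ⟩
    1# + 0#                       ≈⟨ +-identityʳ 1# ⟩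
    1#                            ∎

  α₀β₀-boundary : BoundaryEq α₀ β₀
  α₀β₀-boundary = from-difference (vanishes₂
    (solve 3 (λ a b z →
       a :- z :* ((one :+ a :* a) :* (one :+ b))
       := one :* (a :- z :* (one :+ two :* (a :* a))) :+ (:- z) :* ((one :+ a :^ 2) :* b :- a :^ 2))
       S.refl α₀ β₀ zs)
    (difference α₀-eq) (difference β₀-isBeta))

  -- (1 + α₀²)(α₀β₀ - z(…)) is a combination of the defining equations of
  -- α₀ and β₀, and 1 + α₀² is cancellable
  α₀β₀-interior : InteriorEq α₀ β₀
  α₀β₀-interior = from-difference
    (unit-cancel (1s +s α₀ ^s 2) _ 1# (one-plus-square-unit α₀ α₀-coeff₀) (vanishes₂
      (solve 3 (λ a b z →
         (one :+ a :^ 2) :* (a :* b :- z :* (a :* a :+ b :* b :+ (a :* a) :* (b :* b)))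
         := (a :- z :* (((one :+ a :^ 2) :* b :- a :^ 2) :+ two :* (a :* a))) :* ((one :+ a :^ 2) :* b :- a :^ 2)
            :+ (a :* a) :* (a :- z :* (one :+ two :* (a :* a))))
         S.refl α₀ β₀ zs)
      (difference β₀-isBeta) (difference α₀-eq)))

  α₀²-coeff₂ : (α₀ ^s 2) 2 ≈ 1#
  α₀²-coeff₂ = begin
    (α₀ ^s 2) 2                                         ≈⟨ *s-cong {α₀} (λ _ → refl) (S.*-identityʳ α₀) 2 ⟩
    (α₀ 0 * α₀ 2 + α₀ 1 * α₀ 1) + α₀ 2 * α₀ 0           ≈⟨ +-cong (+-cong (trans (*-congʳ α₀-coeff₀) (zeroˡ _))
                                                                          (trans (*-cong α₀-coeff₁ α₀-coeff₁) (*-identityˡ 1#)))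
                                                                  (trans (*-congˡ α₀-coeff₀) (zeroʳ _)) ⟩
    (0# + 1#) + 0#                                      ≈⟨ trans (+-identityʳ _) (+-identityˡ 1#) ⟩
    1#                                                  ∎

  open import Algebra.Properties.Semiring.Mult.TCOptimised S.semiring using (1+×)

  const-ι : ∀ n → const (ι n) ≋ SeriesSolver.nat n
  const-ι zero    = S.refl
  const-ι (suc n) = S.trans const-+ (S.trans (S.+-congˡ (const-ι n)) (S.sym (1+× n 1s)))
    where
    const-+ : const (ι (suc n)) ≋ 1s +s const (ι n)
    const-+ zero    = refl
    const-+ (suc k) = sym (+-identityʳ 0#)

  s₀ : Series
  s₀ = 1s -s const (ι 4) *s zs *s α₀

  s₀-isSqrt : IsSqrt s₀
  s₀-isSqrt = constant-term , squares
    where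
    constant-term : s₀ 0 ≈ 1#
    constant-term = begin
      1# - (ι 4 * 0#) * α₀ 0   ≈⟨ +-congˡ (-‿cong (trans (*-congʳ (zeroʳ _)) (zeroˡ _))) ⟩
      1# - 0#                  ≈⟨ trans (+-congˡ -0#≈0#) (+-identityʳ 1#) ⟩
      1#                       ∎
    squares : s₀ *s s₀ ≋ 1s -s const (ι 8) *s (zs ^s 2)
    squares = S.trans (S.*-cong s₀≋ s₀≋) (S.trans by-α₀-eq (S.+-congˡ {1s} (S.-‿cong (S.*-congʳ {zs ^s 2} (S.sym (const-ι 8))))))
      where
      s₀≋ : s₀ ≋ 1s -s SeriesSolver.nat 4 *s zs *s α₀
      s₀≋ = S.+-congˡ {1s} (S.-‿cong (S.*-congʳ {α₀} (S.*-congʳ {zs} (const-ι 4))))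
      by-α₀-eq : (1s -s SeriesSolver.nat 4 *s zs *s α₀) *s (1s -s SeriesSolver.nat 4 *s zs *s α₀)
                 ≋ 1s -s SeriesSolver.nat 8 *s (zs ^s 2)
      by-α₀-eq = from-difference (vanishes₁
        (solve 2 (λ a z →
           (one :- con (+ 4) :* z :* a) :* (one :- con (+ 4) :* z :* a) :- (one :- con (+ 8) :* z :^ 2)
           := (:- (con (+ 8) :* z)) :* (a :- z :* (one :+ two :* (a :* a))))
           S.refl α₀ zs)
        (difference α₀-eq))

  -- nonvanishing, square-root uniqueness and uniqueness of the solution
  -- need inverses in R
  module OverField (isField : IsFieldR) where
    1≉0 : ¬ (1# ≈ 0#)
    1≉0 = proj₁ isField

    inverse : ∀ x → ¬ (x ≈ 0#) → Σ Carrier (λ y → x * y ≈ 1#)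
    inverse = proj₂ isField

    α₀-nonzero : NonZeroS α₀
    α₀-nonzero α₀≋0 = 1≉0 (trans (sym α₀-coeff₁) (α₀≋0 1))

    β₀-nonzero : NonZeroS β₀
    β₀-nonzero β₀≋0 = 1≉0 (begin
      1#                              ≈⟨ sym α₀²-coeff₂ ⟩
      (α₀ ^s 2) 2                     ≈⟨ sym (β₀-isBeta 2) ⟩
      ((1s +s α₀ ^s 2) *s β₀) 2       ≈⟨ S.trans (S.*-congˡ {1s +s α₀ ^s 2} β₀≋0) (S.zeroʳ (1s +s α₀ ^s 2)) 2 ⟩
      0#                              ∎)

    solution₀ : Solution α₀ β₀
    solution₀ = α₀-nonzero , β₀-nonzero
              , interior-recurrence α₀ β₀ α₀β₀-interior , boundary-recurrence α₀ β₀ α₀β₀-boundary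

    -- two square roots with constant term 1 differ by a multiple of
    -- s + s₀, whose constant term 2 is invertible in characteristic zero
    sqrt-unique : CharZero → ∀ s → IsSqrt s → s ≋ s₀
    sqrt-unique charZero s (s-coeff₀ , s-squares) = from-difference
      (unit-cancel (s +s s₀) (s -s s₀) half sum-unit (vanishes₂
        (solve 3 (λ a b c → (a :+ b) :* (a :- b) := one :* (a :* a :- c) :+ (:- one) :* (b :* b :- c))
           S.refl s s₀ (1s -s const (ι 8) *s (zs ^s 2)))
        (difference s-squares) (difference (proj₂ s₀-isSqrt))))
      where
      half : Carrier
      half = proj₁ (inverse (ι 2) (charZero 1))
      sum-unit : (s 0 + s₀ 0) * half ≈ 1#
      sum-unit = trans (*-congʳ (trans (+-cong s-coeff₀ (proj₁ s₀-isSqrt)) (+-congˡ (sym (+-identityʳ 1#)))))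
                       (proj₂ (inverse (ι 2) (charZero 1)))

    α₀-isAlpha : CharZero → ∀ s → IsSqrt s → IsAlpha0 s α₀
    α₀-isAlpha charZero s s-isSqrt =
      S.trans (solve 2 (λ x o → x := o :- (o :- x)) S.refl (const (ι 4) *s zs *s α₀) 1s)
              (S.+-congˡ {1s} (S.-‿cong (S.sym (sqrt-unique charZero s s-isSqrt))))

    solution-interior : ∀ α β → Solution α β → InteriorEq α β
    solution-interior α β (_ , _ , interior , _) = from-difference (vanishes₁
      (solve 3 (λ a b z →
         a :* b :- z :* (a :* a :+ b :* b :+ (a :* a) :* (b :* b))
         := one :* ((a :^ 1) :* (b :^ 1) :- z :* ((a :^ 0) :* (b :^ 2) :+ (a :^ 2) :* (b :^ 0) :+ (a :^ 2) :* (b :^ 2))))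
         S.refl α β zs)
      (difference (interior 0 0)))

    solution-boundary×α : ∀ α β → Solution α β → α *s α ≋ zs *s (α *s weight α β)
    solution-boundary×α α β (_ , _ , _ , boundary) = from-difference (vanishes₁
      (solve 3 (λ a b z →
         a :* a :- z :* (a :* ((one :+ a :* a) :* (one :+ b)))
         := one :* ((a :^ 2) :* (b :^ 0) :- z :* ((a :^ 1) :* (b :^ 1) :+ (a :^ 3) :* (b :^ 1)
                                                  :+ (a :^ 1) :* (b :^ 0) :+ (a :^ 3) :* (b :^ 0))))
         S.refl α β zs)
      (difference (boundary 0)))

    open CoeffSolver using () renaming
      (_:+_ to _⊕_; _:*_ to _⊗_; _:-_ to _⊖_; :-_ to ⊝_; con to κ; _:=_ to _≐_)

    -- Every solution is (α₀, β₀).  The key point is that α(1) is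
    -- invertible and α(0) = 0, so that α may be cancelled from the
    -- boundary equation.
    module Uniqueness (α β : Series) (sol : Solution α β) where
      w e : Series
      w = weight α β
      e = α *s α +s β *s β +s (α *s α) *s (β *s β)

      interior : α *s β ≋ zs *s e
      interior = solution-interior α β sol

      boundary×α : α *s α ≋ zs *s (α *s w)
      boundary×α = solution-boundary×α α β sol

      o : ∀ {n} → CoeffSolver.Polynomial n
      o = κ (+ 1)

      α²-coeff₀ : α 0 * α 0 ≈ 0#
      α²-coeff₀ = trans (boundary×α 0) (z*-coeff₀ (α *s w))

      α²-coeff₁ : α 0 * α 1 + α 1 * α 0 ≈ α 0 * w 0
      α²-coeff₁ = trans (boundary×α 1) (z*-coeff-suc (α *s w) 0)

      α²-coeff₂ : (α 0 * α 2 + α 1 * α 1) + α 2 * α 0 ≈ α 0 * w 1 + α 1 * w 0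
      α²-coeff₂ = trans (boundary×α 2) (z*-coeff-suc (α *s w) 1)

      αβ-coeff₀ : α 0 * β 0 ≈ 0#
      αβ-coeff₀ = trans (interior 0) (z*-coeff₀ e)

      αβ-coeff₁ : α 0 * β 1 + α 1 * β 0 ≈ e 0
      αβ-coeff₁ = trans (interior 1) (z*-coeff-suc e 0)

      -- If α(1) = 0 then α(0) = 0 and β(0)² = 0, so α = z²γ where
      -- (w - zγ) γ = 0; the constant term (1 + β(0)) of w - zγ has
      -- inverse 1 - β(0), hence γ = 0 and α = 0.
      α₁-apart : ¬ (α 1 ≈ 0#)
      α₁-apart α₁≈0 = proj₁ sol α≋0
        where
        α₀≈0 : α 0 ≈ 0#
        α₀≈0 = CoeffSolver.vanishes₄
          (CoeffSolver.solve 3 (λ a0 a1 b0 →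
             a0 ≐ (⊝ o) ⊗ ((a0 ⊗ a1 ⊕ a1 ⊗ a0) ⊖ a0 ⊗ ((o ⊕ a0 ⊗ a0) ⊗ (o ⊕ b0)))
                  ⊕ (a0 ⊕ a0) ⊗ a1 ⊕ (⊝ o) ⊗ (a0 ⊗ b0) ⊕ (⊝ (a0 ⊕ a0 ⊗ b0)) ⊗ (a0 ⊗ a0))
             refl (α 0) (α 1) (β 0))
          (CoeffSolver.difference α²-coeff₁) α₁≈0 αβ-coeff₀ α²-coeff₀
        β₀²≈0 : β 0 * β 0 ≈ 0#
        β₀²≈0 = CoeffSolver.vanishes₄
          (CoeffSolver.solve 4 (λ a0 a1 b0 b1 →
             b0 ⊗ b0 ≐ (⊝ o) ⊗ ((a0 ⊗ b1 ⊕ a1 ⊗ b0) ⊖ ((a0 ⊗ a0 ⊕ b0 ⊗ b0) ⊕ (a0 ⊗ a0) ⊗ (b0 ⊗ b0)))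
                       ⊕ b1 ⊗ a0 ⊕ b0 ⊗ a1 ⊕ (⊝ (o ⊕ b0 ⊗ b0)) ⊗ (a0 ⊗ a0))
             refl (α 0) (α 1) (β 0) (β 1))
          (CoeffSolver.difference αβ-coeff₁) α₀≈0 α₁≈0 α²-coeff₀
        γ : Series
        γ = tail (tail α)
        α≋z²γ : α ≋ zs *s (zs *s γ)
        α≋z²γ = S.trans (z-divides α α₀≈0) (S.*-congˡ {zs} (z-divides (tail α) α₁≈0))
        z³-multiple : zs *s (zs *s (zs *s ((w -s zs *s γ) *s γ))) ≋ 0s
        z³-multiple = vanishes₂
          (solve 4 (λ a z g W →
             z :* (z :* (z :* ((W :- z :* g) :* g)))
             := (:- one) :* (a :* a :- z :* (a :* W)) :+ (a :+ z :* (z :* g) :- z :* W) :* (a :- z :* (z :* g)))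
             S.refl α zs γ w)
          (difference boundary×α) (difference α≋z²γ)
        unit : (w 0 - (zs *s γ) 0) * (1# - β 0) ≈ 1#
        unit = CoeffSolver.from-difference (CoeffSolver.vanishes₃
          (CoeffSolver.solve 3 (λ a0 b0 d →
             (((o ⊕ a0 ⊗ a0) ⊗ (o ⊕ b0)) ⊖ d) ⊗ (o ⊖ b0) ⊖ o
             ≐ (⊝ o) ⊗ (b0 ⊗ b0) ⊕ ((o ⊕ b0) ⊗ (o ⊖ b0)) ⊗ (a0 ⊗ a0) ⊕ (⊝ (o ⊖ b0)) ⊗ d)
             refl (α 0) (β 0) ((zs *s γ) 0))
          β₀²≈0 α²-coeff₀ (z*-coeff₀ γ))
        γ≋0 : γ ≋ 0s
        γ≋0 = unit-cancel (w -s zs *s γ) γ (1# - β 0) unit (z-cancel _ (z-cancel _ (z-cancel _ z³-multiple)))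
        α≋0 : α ≋ 0s
        α≋0 = S.trans α≋z²γ (S.trans (S.*-congˡ {zs} (S.trans (S.*-congˡ {zs} γ≋0) (S.zeroʳ zs))) (S.zeroʳ zs))

      α₁⁻¹ : Carrier
      α₁⁻¹ = proj₁ (inverse (α 1) α₁-apart)

      α₁α₁⁻¹ : α 1 * α₁⁻¹ ≈ 1#
      α₁α₁⁻¹ = proj₂ (inverse (α 1) α₁-apart)

      -- coefficient 2 gives α(0)α(1)(α(1) - 1) = 0, so α(0)α(1) = α(0);
      -- with coefficient 1 (2α(0)α(1) = α(0)) this forces α(0) = 0
      α-coeff₀ : α 0 ≈ 0#
      α-coeff₀ = CoeffSolver.vanishes₄
        (CoeffSolver.solve 3 (λ a0 a1 b0 →
           a0 ≐ o ⊗ (a0 ⊗ b0) ⊕ (a0 ⊕ a0 ⊗ b0) ⊗ (a0 ⊗ a0) ⊕ (⊝ (o ⊕ o)) ⊗ (a0 ⊗ a1 ⊖ a0)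
                ⊕ o ⊗ ((a0 ⊗ a1 ⊕ a1 ⊗ a0) ⊖ a0 ⊗ ((o ⊕ a0 ⊗ a0) ⊗ (o ⊕ b0))))
           refl (α 0) (α 1) (β 0))
        αβ-coeff₀ α²-coeff₀ α₀α₁≈α₀ (CoeffSolver.difference α²-coeff₁)
        where
        α₀α₁²≈α₀α₁ : α 0 * α 1 * α 1 - α 0 * α 1 ≈ 0#
        α₀α₁²≈α₀α₁ = CoeffSolver.vanishes₃
          (CoeffSolver.solve 5 (λ a0 a1 a2 b0 w1 →
             a0 ⊗ a1 ⊗ a1 ⊖ a0 ⊗ a1
             ≐ a0 ⊗ (((a0 ⊗ a2 ⊕ a1 ⊗ a1) ⊕ a2 ⊗ a0) ⊖ (a0 ⊗ w1 ⊕ a1 ⊗ ((o ⊕ a0 ⊗ a0) ⊗ (o ⊕ b0))))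
               ⊕ (w1 ⊖ (o ⊕ o) ⊗ a2 ⊕ a0 ⊗ a1 ⊕ a0 ⊗ a1 ⊗ b0) ⊗ (a0 ⊗ a0) ⊕ a1 ⊗ (a0 ⊗ b0))
             refl (α 0) (α 1) (α 2) (β 0) (w 1))
          (CoeffSolver.difference α²-coeff₂) α²-coeff₀ αβ-coeff₀
        α₀α₁≈α₀ : α 0 * α 1 - α 0 ≈ 0#
        α₀α₁≈α₀ = CoeffSolver.vanishes₂
          (CoeffSolver.solve 3 (λ a0 a1 y →
             a0 ⊗ a1 ⊖ a0 ≐ y ⊗ (a0 ⊗ a1 ⊗ a1 ⊖ a0 ⊗ a1) ⊕ (⊝ (a0 ⊗ a1 ⊖ a0)) ⊗ (a1 ⊗ y ⊖ o))
             refl (α 0) (α 1) α₁⁻¹)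
          α₀α₁²≈α₀α₁ (CoeffSolver.difference α₁α₁⁻¹)

      -- α = z·tail α with tail α invertible, so α may be cancelled
      boundary : BoundaryEq α β
      boundary = from-difference (unit-cancel (tail α) _ α₁⁻¹ α₁α₁⁻¹ (z-cancel _ (vanishes₂
        (solve 4 (λ a z a' W →
           z :* (a' :* (a :- z :* W))
           := one :* (a :* a :- z :* (a :* W)) :+ (:- (a :- z :* W)) :* (a :- z :* a'))
           S.refl α zs (tail α) w)
        (difference boundary×α) (difference (z-divides α α-coeff₀)))))

      -- eliminating β between the two equations: α = z (1 + 2α²)
      α-eq : α ≋ αMap α
      α-eq = from-difference (unit-cancel (1s +s α ^s 2) _ 1# (one-plus-square-unit α α-coeff₀) (z-cancel _ (vanishes₂
        (solve 3 (λ a b z →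
           z :* ((one :+ a :^ 2) :* (a :- z :* (one :+ two :* (a :* a))))
           := (z :* (one :+ a :^ 2)) :* (a :* b :- z :* (a :* a :+ b :* b :+ (a :* a) :* (b :* b)))
              :+ ((a :- z :* ((one :+ a :* a) :* (one :+ b))) :- a :+ two :* (z :* (one :+ a :^ 2)))
                 :* (a :- z :* ((one :+ a :* a) :* (one :+ b))))
           S.refl α β zs)
        (difference interior) (difference boundary))))

      α≋α₀ : α ≋ α₀
      α≋α₀ = αMap-unique α α-eq

      α-isBeta : IsBeta0 α β
      α-isBeta = from-difference (z-cancel _ (vanishes₂
        (solve 3 (λ a b z →
           z :* ((one :+ a :^ 2) :* b :- a :^ 2)
           := one :* (a :- z :* (one :+ two :* (a :* a))) :+ (:- one) :* (a :- z :* ((one :+ a :* a) :* (one :+ b))))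
           S.refl α β zs)
        (difference α-eq) (difference boundary)))

      -- β and β₀ are both α₀² / (1 + α₀²)
      β≋β₀ : β ≋ β₀
      β≋β₀ = unit-cancelˡ (1s +s α₀ ^s 2) β β₀ 1# (one-plus-square-unit α₀ α₀-coeff₀)
        (S.trans (S.*-congʳ {β} (S.+-congˡ {1s} (S.sym square≋)))
        (S.trans α-isBeta (S.trans square≋ (S.sym β₀-isBeta))))
        where
        square≋ : α ^s 2 ≋ α₀ ^s 2
        square≋ = S.*-cong α≋α₀ (S.*-cong α≋α₀ (S.refl {1s}))

    unique : ∀ α β → Solution α β → (α ≋ α₀) × (β ≋ β₀)
    unique α β sol = Uniqueness.α≋α₀ α β sol , Uniqueness.β≋β₀ α β sol

lemma2 : {c ℓ : Level} (R : CommutativeRing c ℓ) →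
    let open CommutativeRing R hiding (zero)
        open PowerSeries R
    in IsFieldR → CharZero →
       Σ Series IsSqrt
       × (∀ s → IsSqrt s →
            Σ Series (λ α₀ → Σ Series (λ β₀ →
              IsAlpha0 s α₀ × IsBeta0 α₀ β₀ × Solution α₀ β₀
              × (∀ α β → Solution α β → (α ≋ α₀) × (β ≋ β₀)))))
lemma2 R isField charZero =
  (s₀ , s₀-isSqrt) ,
  λ s s-isSqrt → α₀ , β₀ , α₀-isAlpha charZero s s-isSqrt , β₀-isBeta , solution₀ , unique
  where
  open AlphaBeta R
  open OverField isField
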